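{- Let $n\geq 2$ and let $S$ be a subset of the vertices of the hypercube $Q_n$ such that the induced subgraph $Q_n[S]$ has maximum degree at most one. Then the collection of subsets of $[n]$ corresponding to the vertices of $Q_n$ not in $S$ is the collection of feasible sets of a delta-matroid with ground set $[n]$.
   Context: The $n$-dimensional hypercube $Q_n$ has vertex set $\{0,1\}^n$, two vertices adjacent when they differ in exactly one coordinate; each vertex is identified with the subset of $[n]=\{1,\dots,n\}$ of which it is the indicator vector. A delta-matroid $(E,\mathcal F)$ consists of a finite set $E$ and a non-empty collection $\mathcal F$ of subsets of $E$ satisfying: for all $X,Y\in\mathcal F$ and every $e\in X\bigtriangleup Y$ there exists $f\in X\bigtriangleup Y$ (possibly $f=e$) with $X\bigtriangleup\{e,f\}\in\mathcal F$. -}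

module Defs where

open import Data.Nat using (ℕ)
open import Data.Fin using (Fin; _≟_)
open import Data.Vec using (Vec; lookup; tabulate)
open import Data.Bool using (Bool; true; false; not; _xor_; _∨_)
open import Data.Product using (Σ; _×_; _,_; ∃)
open import Relation.Binary.PropositionalEquality using (_≡_; _≢_)
open import Relation.Nullary.Decidable using (⌊_⌋)

-- A vertex of Q_n, identified with (the indicator vector of) a subset of [n] = Fin n.
Vertex : ℕ → Set
Vertex n = Vec Bool n

_∈△_ : ∀ {n} → Fin n → Vertex n × Vertex n → Set
i ∈△ (X , Y) = (lookup X i xor lookup Y i) ≡ true

Adjacent : ∀ {n} → Vertex n → Vertex n → Set
Adjacent {n} u v = Σ (Fin n) λ i → (lookup u i ≢ lookup v i) × (∀ j → j ≢ i → lookup u j ≡ lookup v j)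

-- X △ {e , f}  (when e = f this is X △ {e}).
toggle₂ : ∀ {n} → Vertex n → Fin n → Fin n → Vertex n
toggle₂ X e f = tabulate λ i → lookup X i xor (⌊ i ≟ e ⌋ ∨ ⌊ i ≟ f ⌋)

IsDeltaMatroid : (n : ℕ) → (Vertex n → Set) → Set
IsDeltaMatroid n F =
  (Σ (Vertex n) F) ×
  (∀ X Y → F X → F Y → ∀ e → e ∈△ (X , Y) →
     Σ (Fin n) λ f → f ∈△ (X , Y) × F (toggle₂ X e f))

MaxDegAtMostOne : (n : ℕ) → (Vertex n → Bool) → Set
MaxDegAtMostOne n S =
  ∀ v u w → S v ≡ true → S u ≡ true → S w ≡ true →
    Adjacent v u → Adjacent v w → u ≡ w

-- The exchange axiom only needs Y ∉ S. Given e ∈ X △ Y, if X △ {e} ∉ S we are done;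
-- otherwise X △ Y has some f ≠ e (else X △ {e} = Y), and if X △ {e,f} ∈ S it has a
-- third element g (else X △ {e,f} = Y). Then X △ {e,f} and X △ {e,g} are distinct
-- neighbours of X △ {e} ∈ S, so X △ {e,g} ∉ S. Non-emptiness is the same degree
-- argument at an arbitrary vertex and two of its neighbours.
module Submission where

open import Defs
open import Data.Nat using (ℕ; _≥_; suc; s≤s; z≤n)
open import Data.Bool using (Bool; true; false; not; _xor_; _∨_)
open import Data.Bool.Properties using (not-¬; xor-identityʳ) renaming (_≟_ to _≟ᵇ_)
open import Data.Fin using (Fin; _≟_; zero; suc)
open import Data.Fin.Properties using (any?)
open import Data.Vec using (lookup; replicate)
open import Data.Vec.Properties using (lookup∘tabulate; tabulate∘lookup; tabulate-cong)
open import Data.Product using (Σ; _×_; _,_)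
open import Relation.Nullary using (¬_; Dec; yes; no; ¬?; contradiction)
open import Relation.Nullary.Decidable using (⌊_⌋; _×-dec_)
open import Relation.Binary.PropositionalEquality

private
  variable
    n : ℕ

vertex-ext : {u v : Vertex n} → (∀ i → lookup u i ≡ lookup v i) → u ≡ v
vertex-ext {u = u} {v} p = trans (sym (tabulate∘lookup u)) (trans (tabulate-cong p) (tabulate∘lookup v))

≢-at : {u v : Vertex n} (i : Fin n) → lookup u i ≢ lookup v i → u ≢ v
≢-at i ne u≡v = ne (cong (λ w → lookup w i) u≡v)

xor-true : ∀ b → b xor true ≡ not b
xor-true false = refl
xor-true true  = refl

xor≢true⇒≡ : ∀ a b → a xor b ≢ true → a ≡ b
xor≢true⇒≡ false false _ = refl
xor≢true⇒≡ false true  h = contradiction refl h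
xor≢true⇒≡ true  false h = contradiction refl h
xor≢true⇒≡ true  true  _ = refl

xor≡true⇒not≡ : ∀ a b → a xor b ≡ true → not a ≡ b
xor≡true⇒not≡ false true  _ = refl
xor≡true⇒not≡ true  false _ = refl

lookup-toggle₂ : ∀ (X : Vertex n) e f i → lookup (toggle₂ X e f) i ≡ lookup X i xor (⌊ i ≟ e ⌋ ∨ ⌊ i ≟ f ⌋)
lookup-toggle₂ X e f i = lookup∘tabulate _ i

lookup-toggle₂-first : ∀ (X : Vertex n) e f → lookup (toggle₂ X e f) e ≡ not (lookup X e)
lookup-toggle₂-first X e f rewrite lookup-toggle₂ X e f e with e ≟ e
... | yes _   = xor-true _
... | no e≢e = contradiction refl e≢e

lookup-toggle₂-second : ∀ (X : Vertex n) e f → lookup (toggle₂ X e f) f ≡ not (lookup X f)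
lookup-toggle₂-second X e f rewrite lookup-toggle₂ X e f f with f ≟ e | f ≟ f
... | yes _ | _       = xor-true _
... | no _  | yes _   = xor-true _
... | no _  | no f≢f = contradiction refl f≢f

lookup-toggle₂-other : ∀ (X : Vertex n) {e f i} → i ≢ e → i ≢ f → lookup (toggle₂ X e f) i ≡ lookup X i
lookup-toggle₂-other X {e} {f} {i} i≢e i≢f rewrite lookup-toggle₂ X e f i with i ≟ e | i ≟ f
... | yes i≡e | _       = contradiction i≡e i≢e
... | no _    | yes i≡f = contradiction i≡f i≢f
... | no _    | no _    = xor-identityʳ _

adjacent-toggle : ∀ (X : Vertex n) e → Adjacent X (toggle₂ X e e)
adjacent-toggle X e =
  e , (λ q → not-¬ refl (trans q (lookup-toggle₂-first X e e))) ,
  λ j j≢e → sym (lookup-toggle₂-other X j≢e j≢e)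

adjacent-toggle-toggle₂ : ∀ (X : Vertex n) {e f} → f ≢ e → Adjacent (toggle₂ X e e) (toggle₂ X e f)
adjacent-toggle-toggle₂ X {e} {f} f≢e = f , differs , agrees
  where
  differs : lookup (toggle₂ X e e) f ≢ lookup (toggle₂ X e f) f
  differs q = not-¬ (lookup-toggle₂-other X f≢e f≢e) (trans q (lookup-toggle₂-second X e f))

  agrees : ∀ j → j ≢ f → lookup (toggle₂ X e e) j ≡ lookup (toggle₂ X e f) j
  agrees j j≢f with j ≟ e
  ... | yes refl = trans (lookup-toggle₂-first X j j) (sym (lookup-toggle₂-first X j f))
  ... | no j≢e   = trans (lookup-toggle₂-other X j≢e j≢e) (sym (lookup-toggle₂-other X j≢e j≢f))

toggle-injective : ∀ (X : Vertex n) {e f} → e ≢ f → toggle₂ X e e ≢ toggle₂ X f f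
toggle-injective X {e} {f} e≢f =
  ≢-at e (λ q → not-¬ (lookup-toggle₂-other X e≢f e≢f) (trans (sym q) (lookup-toggle₂-first X e e)))

toggle₂-injectiveʳ : ∀ (X : Vertex n) {e f g} → f ≢ e → f ≢ g → toggle₂ X e f ≢ toggle₂ X e g
toggle₂-injectiveʳ X {e} {f} {g} f≢e f≢g =
  ≢-at f (λ q → not-¬ (lookup-toggle₂-other X f≢e f≢g) (trans (sym q) (lookup-toggle₂-second X e f)))

toggle₂-≡ : ∀ (X : Vertex n) {Y e f} → e ∈△ (X , Y) → f ∈△ (X , Y) →
            (∀ i → i ≢ e → i ≢ f → ¬ i ∈△ (X , Y)) → toggle₂ X e f ≡ Y
toggle₂-≡ X {Y} {e} {f} e∈ f∈ rest = vertex-ext pointwise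
  where
  pointwise : ∀ i → lookup (toggle₂ X e f) i ≡ lookup Y i
  pointwise i with i ≟ e | i ≟ f
  ... | yes refl | _        = trans (lookup-toggle₂-first X i f) (xor≡true⇒not≡ _ _ e∈)
  ... | no _     | yes refl = trans (lookup-toggle₂-second X e i) (xor≡true⇒not≡ _ _ f∈)
  ... | no i≢e   | no i≢f   = trans (lookup-toggle₂-other X i≢e i≢f) (xor≢true⇒≡ _ _ (rest i i≢e i≢f))

∈△? : ∀ (X Y : Vertex n) i → Dec (i ∈△ (X , Y))
∈△? X Y i = (lookup X i xor lookup Y i) ≟ᵇ true

toggle₂≢⇒third-∈△ : ∀ (X : Vertex n) {Y e f} → e ∈△ (X , Y) → f ∈△ (X , Y) → toggle₂ X e f ≢ Y →
                     Σ (Fin n) λ g → g ≢ e × g ≢ f × g ∈△ (X , Y)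
toggle₂≢⇒third-∈△ X {Y} {e} {f} e∈ f∈ ≢Y
  with any? (λ g → ¬? (g ≟ e) ×-dec (¬? (g ≟ f) ×-dec ∈△? X Y g))
... | yes third = third
... | no none   = contradiction (toggle₂-≡ X e∈ f∈ λ i i≢e i≢f i∈ → none (i , i≢e , i≢f , i∈)) ≢Y

module _ {S : Vertex n → Bool} (maxDeg : MaxDegAtMostOne n S) where

  ∈S-≢-∉S : ∀ {u v : Vertex n} → S u ≡ true → S v ≡ false → u ≢ v
  ∈S-≢-∉S u∈ v∉ refl = contradiction (trans (sym u∈) v∉) λ ()

  other-neighbour-∉S : ∀ {v u w} → S v ≡ true → Adjacent v u → Adjacent v w → u ≢ w →
                       S u ≡ true → S w ≡ false
  other-neighbour-∉S {w = w} v∈ v~u v~w u≢w u∈ with S w in w∈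
  ... | false = refl
  ... | true  = contradiction (maxDeg _ _ _ v∈ u∈ w∈ v~u v~w) u≢w

  ∃-∉S : ∀ {e f} → e ≢ f → Vertex n → Σ (Vertex n) λ V → S V ≡ false
  ∃-∉S {e} {f} e≢f X with S X in X∈ | S (toggle₂ X e e) in Xe∈
  ... | false | _     = X , X∈
  ... | true  | false = toggle₂ X e e , Xe∈
  ... | true  | true  = toggle₂ X f f ,
        other-neighbour-∉S X∈ (adjacent-toggle X e) (adjacent-toggle X f) (toggle-injective X e≢f) Xe∈

  exchange : ∀ (X Y : Vertex n) → S Y ≡ false → ∀ e → e ∈△ (X , Y) →
             Σ (Fin n) λ f → f ∈△ (X , Y) × S (toggle₂ X e f) ≡ false
  exchange X Y Y∉ e e∈ with S (toggle₂ X e e) in Xe∈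
  ... | false = e , e∈ , Xe∈
  ... | true with toggle₂≢⇒third-∈△ X e∈ e∈ (∈S-≢-∉S Xe∈ Y∉)
  ... | f , f≢e , _ , f∈ with S (toggle₂ X e f) in Xef∈
  ... | false = f , f∈ , Xef∈
  ... | true with toggle₂≢⇒third-∈△ X e∈ f∈ (∈S-≢-∉S Xef∈ Y∉)
  ... | g , g≢e , g≢f , g∈ =
        g , g∈ , other-neighbour-∉S Xe∈ (adjacent-toggle-toggle₂ X f≢e) (adjacent-toggle-toggle₂ X g≢e)
                   (toggle₂-injectiveʳ X f≢e (≢-sym g≢f)) Xef∈

lemma9 : (n : ℕ) → n ≥ 2 → (S : Vertex n → Bool) → MaxDegAtMostOne n S →
    IsDeltaMatroid n (λ X → S X ≡ false)
lemma9 (suc (suc m)) (s≤s (s≤s z≤n)) S maxDeg =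
  ∃-∉S maxDeg {zero} {suc zero} (λ ()) (replicate _ false) ,
  λ X Y _ Y∉ → exchange maxDeg X Y Y∉
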